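{- Let $d\ge 0$ and $n=2^d$. The number of inputs $X\in\{0,1\}^n$ such that $\operatorname{T}_d(X)=\textsc{Par}(X)$ is exactly $2^{n-1}+1$ if $d$ is even, and exactly $2^{n-1}-1$ if $d$ is odd.
   Context: $\textsc{Par}(X)=x_1\oplus\cdots\oplus x_n$. The complete binary AND/OR tree is defined recursively by $\operatorname{T}_0(x)=x$ and, for $d>0$ and $n=2^d$, $\operatorname{T}_d(x_1,\dots,x_n)=\operatorname{T}_{d-1}(x_1,\dots,x_{n/2})\wedge \operatorname{T}_{d-1}(x_{n/2+1},\dots,x_n)$ if $d$ is odd, and $\operatorname{T}_d(x_1,\dots,x_n)=\operatorname{T}_{d-1}(x_1,\dots,x_{n/2})\vee \operatorname{T}_{d-1}(x_{n/2+1},\dots,x_n)$ if $d$ is even. -}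

module Defs where

open import Data.Bool using (Bool; true; false; _∧_; _∨_; _xor_; if_then_else_)
open import Data.Nat using (ℕ; zero; suc; _+_; _^_)
open import Data.Nat.Base using (_%_)
open import Data.Vec using (Vec; []; _∷_; splitAt; foldr; cast)
open import Data.List using (List; []; _∷_; map; _++_; length; filter)
open import Data.Product using (_,_)
open import Relation.Nullary.Decidable using (does)
open import Data.Bool.Properties using () renaming (_≟_ to _≟ᵇ_)
open import Data.Nat.Properties using (+-identityʳ)

isOdd : ℕ → Bool
isOdd zero = false
isOdd (suc d) with isOdd d
... | true = false
... | false = true

Par : ∀ {n} → Vec Bool n → Bool
Par = foldr _ _xor_ false

T : (d : ℕ) → Vec Bool (2 ^ d) → Bool
T zero (x ∷ []) = x
T (suc d) xs with splitAt (2 ^ d) xs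
... | l , r₀ , _ = if isOdd (suc d) then (T d l ∧ T d r) else (T d l ∨ T d r)
  where
  -- 2^(d+1) = 2^d + (2^d + 0); the right half has length 2^d + 0
  r : Vec Bool (2 ^ d)
  r = cast (+-identityʳ (2 ^ d)) r₀

allInputs : (n : ℕ) → List (Vec Bool n)
allInputs zero = [] ∷ []
allInputs (suc n) = map (false ∷_) (allInputs n) ++ map (true ∷_) (allInputs n)

agreeCount : ℕ → ℕ
agreeCount d = length (filter (λ X → T d X ≟ᵇ Par X) (allInputs (2 ^ d)))

-- Encode truth values as signs, χ false = 1 and χ true = -1, and measure how often f agrees with parity by
-- its correlation ∑_X χ(f X) χ(Par X); then the number of agreements is (2ⁿ + correlation) / 2.
-- Since 2 χ(x ∧ y) = 1 + χ x + χ y - χ x χ y (dually for ∨) and parity is balanced on every nonempty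
-- block of variables, the correlation of f ∧ g (resp. f ∨ g) on disjoint blocks is -1/2 (resp. 1/2) times
-- the product of the correlations of f and g. Starting from 2 for T₀ this gives ±2 for every T_d,
-- negative exactly at odd depth.
module Submission where

open import Defs
open import Data.Bool using (Bool; true; false; _∧_; _∨_; _xor_; if_then_else_)
open import Data.Bool.Properties using () renaming (_≟_ to _≟ᵇ_)
open import Data.Nat as ℕ using (ℕ; zero; suc; _+_; _∸_; _^_; NonZero)
open import Data.Nat.Properties using (+-identityʳ; m^n≢0; m^n>0; suc-pred)
open import Data.Integer as ℤ using (ℤ; +_; 0ℤ; 1ℤ; -1ℤ)
import Data.Integer.Properties as ℤ
open import Data.Integer.Tactic.RingSolver using (solve-∀)
open import Data.List using (List; []; _∷_; map; filter; length)
import Data.List as List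
open import Data.List.Properties using (length-++; length-map)
open import Data.Vec using (Vec; []; _∷_; splitAt; cast; _++_)
open import Data.Vec.Properties using (cast-is-id)
open import Data.Product using (_×_; _,_)
open import Function using (_∘_)
open import Relation.Binary.PropositionalEquality
  using (_≡_; refl; sym; trans; cong; cong₂; subst; module ≡-Reasoning)
open import Relation.Nullary.Decidable using (does)
open import Relation.Unary using (Decidable)

andOr : Bool → Bool → Bool → Bool
andOr o x y = if o then x ∧ y else x ∨ y

χ : Bool → ℤ
χ false = 1ℤ
χ true  = -1ℤ

χ-xor : ∀ a b → χ (a xor b) ≡ χ a ℤ.* χ b
χ-xor false b     = sym (ℤ.*-identityˡ (χ b))
χ-xor true  false = refl
χ-xor true  true  = refl

indicator : Bool → ℤ
indicator false = 0ℤ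
indicator true  = 1ℤ

indicator-≟ : ∀ a b → + 2 ℤ.* indicator (does (a ≟ᵇ b)) ≡ 1ℤ ℤ.+ χ a ℤ.* χ b
indicator-≟ false false = refl
indicator-≟ false true  = refl
indicator-≟ true  false = refl
indicator-≟ true  true  = refl

χ-andOr : ∀ o x y → + 2 ℤ.* χ (andOr o x y) ≡ χ x ℤ.+ χ y ℤ.+ χ o ℤ.* (χ x ℤ.* χ y ℤ.- 1ℤ)
χ-andOr true  true  true  = refl
χ-andOr true  true  false = refl
χ-andOr true  false true  = refl
χ-andOr true  false false = refl
χ-andOr false true  true  = refl
χ-andOr false true  false = refl
χ-andOr false false true  = refl
χ-andOr false false false = refl

module _ {A : Set} where

  ∑ : List A → (A → ℤ) → ℤ
  ∑ []       f = 0ℤ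
  ∑ (x ∷ xs) f = f x ℤ.+ ∑ xs f

  ∑-cong : ∀ xs {f g : A → ℤ} → (∀ x → f x ≡ g x) → ∑ xs f ≡ ∑ xs g
  ∑-cong []       f≗g = refl
  ∑-cong (x ∷ xs) f≗g = cong₂ ℤ._+_ (f≗g x) (∑-cong xs f≗g)

  ∑-++ : ∀ xs ys (f : A → ℤ) → ∑ (xs List.++ ys) f ≡ ∑ xs f ℤ.+ ∑ ys f
  ∑-++ []       ys f = sym (ℤ.+-identityˡ (∑ ys f))
  ∑-++ (x ∷ xs) ys f = trans (cong (ℤ._+_ (f x)) (∑-++ xs ys f)) (sym (ℤ.+-assoc (f x) _ _))

  ∑-+ : ∀ xs (f g : A → ℤ) → ∑ xs (λ x → f x ℤ.+ g x) ≡ ∑ xs f ℤ.+ ∑ xs g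
  ∑-+ []       f g = refl
  ∑-+ (x ∷ xs) f g = trans (cong (ℤ._+_ (f x ℤ.+ g x)) (∑-+ xs f g)) (interchange (f x) (g x) _ _)
    where
    interchange : ∀ a b c e → a ℤ.+ b ℤ.+ (c ℤ.+ e) ≡ a ℤ.+ c ℤ.+ (b ℤ.+ e)
    interchange = solve-∀

  ∑-*ˡ : ∀ xs c (f : A → ℤ) → ∑ xs (λ x → c ℤ.* f x) ≡ c ℤ.* ∑ xs f
  ∑-*ˡ []       c f = sym (ℤ.*-zeroʳ c)
  ∑-*ˡ (x ∷ xs) c f = trans (cong (ℤ._+_ (c ℤ.* f x)) (∑-*ˡ xs c f)) (sym (ℤ.*-distribˡ-+ c (f x) _))

∑-map : ∀ {A B : Set} (g : A → B) xs (f : B → ℤ) → ∑ (map g xs) f ≡ ∑ xs (f ∘ g)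
∑-map g []       f = refl
∑-map g (x ∷ xs) f = cong (ℤ._+_ (f (g x))) (∑-map g xs f)

∑-product : ∀ {A B : Set} xs ys (f : A → ℤ) (g : B → ℤ) →
            ∑ xs (λ x → ∑ ys (λ y → f x ℤ.* g y)) ≡ ∑ xs f ℤ.* ∑ ys g
∑-product xs ys f g = begin
  ∑ xs (λ x → ∑ ys (λ y → f x ℤ.* g y)) ≡⟨ ∑-cong xs (λ x → ∑-*ˡ ys (f x) g) ⟩
  ∑ xs (λ x → f x ℤ.* ∑ ys g)           ≡⟨ ∑-cong xs (λ x → ℤ.*-comm (f x) _) ⟩
  ∑ xs (λ x → ∑ ys g ℤ.* f x)           ≡⟨ ∑-*ˡ xs (∑ ys g) f ⟩
  ∑ ys g ℤ.* ∑ xs f                     ≡⟨ ℤ.*-comm (∑ ys g) _ ⟩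
  ∑ xs f ℤ.* ∑ ys g                     ∎
  where open ≡-Reasoning

∑∑-+ : ∀ {A B : Set} xs ys (f g : A → B → ℤ) →
       ∑ xs (λ x → ∑ ys (λ y → f x y ℤ.+ g x y))
       ≡ ∑ xs (λ x → ∑ ys (f x)) ℤ.+ ∑ xs (λ x → ∑ ys (g x))
∑∑-+ xs ys f g = trans (∑-cong xs (λ x → ∑-+ ys (f x) (g x))) (∑-+ xs _ _)

∑-allInputs-suc : ∀ n (f : Vec Bool (suc n) → ℤ) →
  ∑ (allInputs (suc n)) f ≡ ∑ (allInputs n) (f ∘ (false ∷_)) ℤ.+ ∑ (allInputs n) (f ∘ (true ∷_))
∑-allInputs-suc n f = trans (∑-++ (map (false ∷_) (allInputs n)) _ f)
  (cong₂ ℤ._+_ (∑-map _ (allInputs n) f) (∑-map _ (allInputs n) f))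

∑-allInputs-++ : ∀ m k (f : Vec Bool (m + k) → ℤ) →
  ∑ (allInputs (m + k)) f ≡ ∑ (allInputs m) (λ l → ∑ (allInputs k) (λ r → f (l ++ r)))
∑-allInputs-++ zero    k f = sym (ℤ.+-identityʳ _)
∑-allInputs-++ (suc m) k f = begin
  ∑ (allInputs (suc m + k)) f
    ≡⟨ ∑-allInputs-suc (m + k) f ⟩
  ∑ (allInputs (m + k)) (f ∘ (false ∷_)) ℤ.+ ∑ (allInputs (m + k)) (f ∘ (true ∷_))
    ≡⟨ cong₂ ℤ._+_ (∑-allInputs-++ m k (f ∘ (false ∷_))) (∑-allInputs-++ m k (f ∘ (true ∷_))) ⟩
  ∑ (allInputs m) (λ l → ∑ (allInputs k) (λ r → f ((false ∷ l) ++ r)))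
    ℤ.+ ∑ (allInputs m) (λ l → ∑ (allInputs k) (λ r → f ((true ∷ l) ++ r)))
    ≡⟨ sym (∑-allInputs-suc m _) ⟩
  ∑ (allInputs (suc m)) (λ l → ∑ (allInputs k) (λ r → f (l ++ r)))
    ∎
  where open ≡-Reasoning

length-allInputs : ∀ n → length (allInputs n) ≡ 2 ^ n
length-allInputs zero    = refl
length-allInputs (suc n) = begin
  length (map (false ∷_) (allInputs n) List.++ map (true ∷_) (allInputs n))
    ≡⟨ length-++ (map (false ∷_) (allInputs n)) ⟩
  length (map (false ∷_) (allInputs n)) + length (map (true ∷_) (allInputs n))
    ≡⟨ cong₂ _+_ (length-map _ (allInputs n)) (length-map _ (allInputs n)) ⟩
  length (allInputs n) + length (allInputs n)
    ≡⟨ cong₂ _+_ (length-allInputs n) (trans (length-allInputs n) (sym (+-identityʳ _))) ⟩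
  2 ^ suc n
    ∎
  where open ≡-Reasoning

χ-Par-++ : ∀ {m k} (l : Vec Bool m) (r : Vec Bool k) → χ (Par (l ++ r)) ≡ χ (Par l) ℤ.* χ (Par r)
χ-Par-++ []      r = sym (ℤ.*-identityˡ _)
χ-Par-++ (x ∷ l) r = begin
  χ (x xor Par (l ++ r))               ≡⟨ χ-xor x _ ⟩
  χ x ℤ.* χ (Par (l ++ r))             ≡⟨ cong (ℤ._*_ (χ x)) (χ-Par-++ l r) ⟩
  χ x ℤ.* (χ (Par l) ℤ.* χ (Par r))    ≡⟨ sym (ℤ.*-assoc (χ x) _ _) ⟩
  χ x ℤ.* χ (Par l) ℤ.* χ (Par r)      ≡⟨ cong (ℤ._* χ (Par r)) (sym (χ-xor x (Par l))) ⟩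
  χ (x xor Par l) ℤ.* χ (Par r)        ∎
  where open ≡-Reasoning

∑-χ-Par≡0 : ∀ n .{{_ : NonZero n}} → ∑ (allInputs n) (χ ∘ Par) ≡ 0ℤ
∑-χ-Par≡0 (suc n) = begin
  ∑ (allInputs (suc n)) (χ ∘ Par)
    ≡⟨ ∑-allInputs-suc n (χ ∘ Par) ⟩
  S ℤ.+ ∑ (allInputs n) (λ v → χ (true xor Par v))
    ≡⟨ cong (ℤ._+_ S) (∑-cong (allInputs n) (χ-xor true ∘ Par)) ⟩
  S ℤ.+ ∑ (allInputs n) (λ v → -1ℤ ℤ.* χ (Par v))
    ≡⟨ cong (ℤ._+_ S) (∑-*ˡ (allInputs n) -1ℤ (χ ∘ Par)) ⟩
  S ℤ.+ -1ℤ ℤ.* S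
    ≡⟨ cancel S ⟩
  0ℤ
    ∎
  where
  open ≡-Reasoning
  S = ∑ (allInputs n) (χ ∘ Par)
  cancel : ∀ s → s ℤ.+ -1ℤ ℤ.* s ≡ 0ℤ
  cancel = solve-∀

correlation : ∀ {n} → (Vec Bool n → Bool) → ℤ
correlation {n} f = ∑ (allInputs n) (λ X → χ (f X) ℤ.* χ (Par X))

correlation-cast : ∀ {m k} (eq : m ≡ k) (f : Vec Bool k → Bool) → correlation (f ∘ cast eq) ≡ correlation f
correlation-cast {m} refl f =
  ∑-cong (allInputs m) (λ X → cong (λ v → χ (f v) ℤ.* χ (Par X)) (cast-is-id refl X))

χ-andOr-separable : ∀ o x y p q →
  + 2 ℤ.* (χ (andOr o x y) ℤ.* (χ p ℤ.* χ q))
  ≡ χ x ℤ.* χ p ℤ.* χ q ℤ.+ (χ p ℤ.* (χ y ℤ.* χ q ℤ.- χ o ℤ.* χ q) ℤ.+ χ o ℤ.* (χ x ℤ.* χ p) ℤ.* (χ y ℤ.* χ q))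
χ-andOr-separable o x y p q = begin
  + 2 ℤ.* (χ (andOr o x y) ℤ.* (χ p ℤ.* χ q))
    ≡⟨ ℤ.*-assoc (+ 2) (χ (andOr o x y)) (χ p ℤ.* χ q) ⟨
  + 2 ℤ.* χ (andOr o x y) ℤ.* (χ p ℤ.* χ q)
    ≡⟨ cong (ℤ._* (χ p ℤ.* χ q)) (χ-andOr o x y) ⟩
  (χ x ℤ.+ χ y ℤ.+ χ o ℤ.* (χ x ℤ.* χ y ℤ.- 1ℤ)) ℤ.* (χ p ℤ.* χ q)
    ≡⟨ expand (χ o) (χ x) (χ y) (χ p) (χ q) ⟩
  χ x ℤ.* χ p ℤ.* χ q ℤ.+ (χ p ℤ.* (χ y ℤ.* χ q ℤ.- χ o ℤ.* χ q) ℤ.+ χ o ℤ.* (χ x ℤ.* χ p) ℤ.* (χ y ℤ.* χ q))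
    ∎
  where
  open ≡-Reasoning
  expand : ∀ o x y p q →
    (x ℤ.+ y ℤ.+ o ℤ.* (x ℤ.* y ℤ.- 1ℤ)) ℤ.* (p ℤ.* q)
    ≡ x ℤ.* p ℤ.* q ℤ.+ (p ℤ.* (y ℤ.* q ℤ.- o ℤ.* q) ℤ.+ o ℤ.* (x ℤ.* p) ℤ.* (y ℤ.* q))
  expand = solve-∀

correlation-andOr : ∀ {m k} .{{_ : NonZero m}} .{{_ : NonZero k}} o
  (f : Vec Bool m → Bool) (g : Vec Bool k → Bool) (h : Vec Bool (m + k) → Bool) →
  (∀ l r → h (l ++ r) ≡ andOr o (f l) (g r)) →
  + 2 ℤ.* correlation h ≡ χ o ℤ.* (correlation f ℤ.* correlation g)
correlation-andOr {m} {k} o f g h h-split = begin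
  + 2 ℤ.* correlation h
    ≡⟨ ∑-*ˡ (allInputs (m + k)) (+ 2) _ ⟨
  ∑ (allInputs (m + k)) (λ X → + 2 ℤ.* (χ (h X) ℤ.* χ (Par X)))
    ≡⟨ ∑-allInputs-++ m k _ ⟩
  ∑ L (λ l → ∑ R (λ r → + 2 ℤ.* (χ (h (l ++ r)) ℤ.* χ (Par (l ++ r)))))
    ≡⟨ ∑-cong L (λ l → ∑-cong R (λ r → expand l r)) ⟩
  ∑ L (λ l → ∑ R (λ r → t₁ l r ℤ.+ (t₂ l r ℤ.+ t₃ l r)))
    ≡⟨ ∑∑-+ L R t₁ (λ l r → t₂ l r ℤ.+ t₃ l r) ⟩
  ∑ L (λ l → ∑ R (t₁ l)) ℤ.+ ∑ L (λ l → ∑ R (λ r → t₂ l r ℤ.+ t₃ l r))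
    ≡⟨ cong (ℤ._+_ (∑ L (λ l → ∑ R (t₁ l)))) (∑∑-+ L R t₂ t₃) ⟩
  ∑ L (λ l → ∑ R (t₁ l)) ℤ.+ (∑ L (λ l → ∑ R (t₂ l)) ℤ.+ ∑ L (λ l → ∑ R (t₃ l)))
    ≡⟨ cong₂ ℤ._+_ (∑-product L R F P) (cong₂ ℤ._+_ (∑-product L R P B) (∑-product L R χF G)) ⟩
  ∑ L F ℤ.* ∑ R P ℤ.+ (∑ L P ℤ.* ∑ R B ℤ.+ ∑ L χF ℤ.* ∑ R G)
    ≡⟨ cong₂ (λ a b → ∑ L F ℤ.* a ℤ.+ (b ℤ.* ∑ R B ℤ.+ ∑ L χF ℤ.* ∑ R G)) (∑-χ-Par≡0 k) (∑-χ-Par≡0 m) ⟩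
  ∑ L F ℤ.* 0ℤ ℤ.+ (0ℤ ℤ.* ∑ R B ℤ.+ ∑ L χF ℤ.* ∑ R G)
    ≡⟨ cong (λ a → ∑ L F ℤ.* 0ℤ ℤ.+ (0ℤ ℤ.* ∑ R B ℤ.+ a ℤ.* ∑ R G)) (∑-*ˡ L (χ o) F) ⟩
  ∑ L F ℤ.* 0ℤ ℤ.+ (0ℤ ℤ.* ∑ R B ℤ.+ χ o ℤ.* ∑ L F ℤ.* ∑ R G)
    ≡⟨ collapse (∑ L F) (∑ R B) (χ o) (∑ R G) ⟩
  χ o ℤ.* (correlation f ℤ.* correlation g)
    ∎
  where
  open ≡-Reasoning
  L = allInputs m
  R = allInputs k
  P : ∀ {n} → Vec Bool n → ℤ
  P = χ ∘ Par
  F : Vec Bool m → ℤ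
  F l = χ (f l) ℤ.* P l
  G : Vec Bool k → ℤ
  G r = χ (g r) ℤ.* P r
  χF : Vec Bool m → ℤ
  χF l = χ o ℤ.* F l
  B : Vec Bool k → ℤ
  B r = G r ℤ.- χ o ℤ.* P r
  -- after summation only t₃ survives: t₁ and t₂ carry the balanced parity P of a whole block
  t₁ t₂ t₃ : Vec Bool m → Vec Bool k → ℤ
  t₁ l r = F l ℤ.* P r
  t₂ l r = P l ℤ.* B r
  t₃ l r = χF l ℤ.* G r
  expand : ∀ l r → + 2 ℤ.* (χ (h (l ++ r)) ℤ.* χ (Par (l ++ r))) ≡ t₁ l r ℤ.+ (t₂ l r ℤ.+ t₃ l r)
  expand l r rewrite h-split l r | χ-Par-++ l r = χ-andOr-separable o (f l) (g r) (Par l) (Par r)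
  collapse : ∀ a b c e → a ℤ.* 0ℤ ℤ.+ (0ℤ ℤ.* b ℤ.+ c ℤ.* a ℤ.* e) ≡ c ℤ.* (a ℤ.* e)
  collapse = solve-∀

splitAt-++ : ∀ {A : Set} m {k} (l : Vec A m) (r : Vec A k) → splitAt m (l ++ r) ≡ (l , r , refl)
splitAt-++ zero    []      r = refl
splitAt-++ (suc m) (x ∷ l) r rewrite splitAt-++ m l r = refl

T-suc-++ : ∀ d (l : Vec Bool (2 ^ d)) (r : Vec Bool (2 ^ d + 0)) →
  T (suc d) (l ++ r) ≡ andOr (isOdd (suc d)) (T d l) (T d (cast (+-identityʳ (2 ^ d)) r))
T-suc-++ d l r rewrite splitAt-++ (2 ^ d) l r = refl

correlation-T : ∀ d → correlation (T d) ≡ + 2 ℤ.* χ (isOdd d)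
correlation-T zero    = refl
correlation-T (suc d) = ℤ.*-cancelˡ-≡ (+ 2) _ _ (begin
  + 2 ℤ.* correlation (T (suc d))
    ≡⟨ correlation-andOr o (T d) (T d ∘ cast half) (T (suc d)) (T-suc-++ d) ⟩
  χ o ℤ.* (correlation (T d) ℤ.* correlation (T d ∘ cast half))
    ≡⟨ cong (λ c → χ o ℤ.* (correlation (T d) ℤ.* c)) (correlation-cast half (T d)) ⟩
  χ o ℤ.* (correlation (T d) ℤ.* correlation (T d))
    ≡⟨ cong (λ c → χ o ℤ.* (c ℤ.* c)) (correlation-T d) ⟩
  χ o ℤ.* ((+ 2 ℤ.* χ (isOdd d)) ℤ.* (+ 2 ℤ.* χ (isOdd d)))
    ≡⟨ square-±2 o (isOdd d) ⟩
  + 2 ℤ.* (+ 2 ℤ.* χ o)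
    ∎)
  where
  open ≡-Reasoning
  o = isOdd (suc d)
  half = +-identityʳ (2 ^ d)
  instance
    left-nonZero : NonZero (2 ^ d)
    left-nonZero = m^n≢0 2 d
    right-nonZero : NonZero (2 ^ d + 0)
    right-nonZero = subst NonZero (sym half) left-nonZero
  square-±2 : ∀ a b → χ a ℤ.* ((+ 2 ℤ.* χ b) ℤ.* (+ 2 ℤ.* χ b)) ≡ + 2 ℤ.* (+ 2 ℤ.* χ a)
  square-±2 false false = refl
  square-±2 false true  = refl
  square-±2 true  false = refl
  square-±2 true  true  = refl

length≡∑1 : ∀ {A : Set} (xs : List A) → + length xs ≡ ∑ xs (λ _ → 1ℤ)
length≡∑1 []       = refl
length≡∑1 (x ∷ xs) = cong (ℤ._+_ 1ℤ) (length≡∑1 xs)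

length-filter≡∑ : ∀ {A : Set} {P : A → Set} (P? : Decidable P) xs →
  + length (filter P? xs) ≡ ∑ xs (indicator ∘ does ∘ P?)
length-filter≡∑ P? []       = refl
length-filter≡∑ P? (x ∷ xs) with does (P? x)
... | true  = cong (ℤ._+_ 1ℤ) (length-filter≡∑ P? xs)
... | false = trans (length-filter≡∑ P? xs) (sym (ℤ.+-identityˡ _))

agreeCount-correlation : ∀ d → + 2 ℤ.* + agreeCount d ≡ + 2 ^ 2 ^ d ℤ.+ correlation (T d)
agreeCount-correlation d = begin
  + 2 ℤ.* + agreeCount d
    ≡⟨ cong (ℤ._*_ (+ 2)) (length-filter≡∑ agree? X) ⟩
  + 2 ℤ.* ∑ X (indicator ∘ does ∘ agree?)
    ≡⟨ ∑-*ˡ X (+ 2) (indicator ∘ does ∘ agree?) ⟨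
  ∑ X (λ x → + 2 ℤ.* indicator (does (agree? x)))
    ≡⟨ ∑-cong X (λ x → indicator-≟ (T d x) (Par x)) ⟩
  ∑ X (λ x → 1ℤ ℤ.+ χ (T d x) ℤ.* χ (Par x))
    ≡⟨ ∑-+ X (λ _ → 1ℤ) _ ⟩
  ∑ X (λ _ → 1ℤ) ℤ.+ correlation (T d)
    ≡⟨ cong (ℤ._+ correlation (T d)) (trans (sym (length≡∑1 X)) (cong +_ (length-allInputs (2 ^ d)))) ⟩
  + 2 ^ 2 ^ d ℤ.+ correlation (T d)
    ∎
  where
  open ≡-Reasoning
  X = allInputs (2 ^ d)
  agree? : Decidable (λ x → T d x ≡ Par x)
  agree? x = T d x ≟ᵇ Par x

agreeCount≡ : ∀ d → + agreeCount d ≡ + 2 ^ (2 ^ d ∸ 1) ℤ.+ χ (isOdd d)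
agreeCount≡ d = ℤ.*-cancelˡ-≡ (+ 2) _ _ (begin
  + 2 ℤ.* + agreeCount d
    ≡⟨ agreeCount-correlation d ⟩
  + 2 ^ 2 ^ d ℤ.+ correlation (T d)
    ≡⟨ cong₂ (λ n c → + 2 ^ n ℤ.+ c) (sym (suc-pred (2 ^ d) {{m^n≢0 2 d}})) (correlation-T d) ⟩
  + (2 ℕ.* 2 ^ k) ℤ.+ + 2 ℤ.* χ (isOdd d)
    ≡⟨ cong (ℤ._+ + 2 ℤ.* χ (isOdd d)) (ℤ.pos-* 2 (2 ^ k)) ⟩
  + 2 ℤ.* + 2 ^ k ℤ.+ + 2 ℤ.* χ (isOdd d)
    ≡⟨ ℤ.*-distribˡ-+ (+ 2) (+ 2 ^ k) (χ (isOdd d)) ⟨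
  + 2 ℤ.* (+ 2 ^ k ℤ.+ χ (isOdd d))
    ∎)
  where
  open ≡-Reasoning
  k = 2 ^ d ∸ 1

proposition10 : (d : ℕ) →
    (isOdd d ≡ false → agreeCount d ≡ 2 ^ (2 ^ d ∸ 1) + 1) × (isOdd d ≡ true → agreeCount d ≡ 2 ^ (2 ^ d ∸ 1) ∸ 1)
proposition10 d = even , odd
  where
  k = 2 ^ d ∸ 1
  even : isOdd d ≡ false → agreeCount d ≡ 2 ^ k + 1
  even d-even = ℤ.+-injective (trans (agreeCount≡ d) (cong (λ o → + 2 ^ k ℤ.+ χ o) d-even))
  odd : isOdd d ≡ true → agreeCount d ≡ 2 ^ k ∸ 1
  odd d-odd = ℤ.+-injective (begin
    + agreeCount d           ≡⟨ agreeCount≡ d ⟩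
    + 2 ^ k ℤ.+ χ (isOdd d)  ≡⟨ cong (λ o → + 2 ^ k ℤ.+ χ o) d-odd ⟩
    2 ^ k ℤ.⊖ 1              ≡⟨ ℤ.⊖-≥ (m^n>0 2 k) ⟩
    + (2 ^ k ∸ 1)            ∎)
    where open ≡-Reasoning
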